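{- Let $\Gamma$ be the directed graph whose vertices are the combinatorial isomorphism classes of flag simplicial $2$-spheres, with a directed edge from the class of $K'$ to the class of $K$ whenever $K'$ is isomorphic to $K/e$ for some edge $e$ of $K$. For a flag simplicial $2$-sphere $K$ with corresponding vertex $v_K$, the input degree of $v_K$ in $\Gamma$ is at most the number of edges of $K$ not contained in any belt of $K$.
   Context: A simplicial complex is flag if every set of pairwise adjacent vertices spans a simplex. $K/e$ is the edge contraction: replace $\operatorname{st}_K v_1\cup \operatorname{st}_K v_2$ by the star of a new vertex (topologically shrink $e=\{v_1,v_2\}$, identify multiple edges, remove degenerate faces). A belt is a set of four vertices whose full subcomplex is the boundary of a square (a $4$-cycle without diagonals). $\Gamma$ is the Hasse diagram of the partial order on flag simplicial $2$-spheres generated by edge contractions, with contracted spheres smaller. -}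

module Defs where

open import Data.Bool using (Bool; true; false; _∧_; _∨_; not; T; if_then_else_)
import Data.Bool as B
open import Data.Nat using (ℕ; zero; suc; _+_; _≤_; _≡ᵇ_; _<ᵇ_)
open import Data.Fin using (Fin; _≟_; punchOut; toℕ)
open import Data.Fin.Subset using (Subset; ⁅_⁆; _∪_; _∈_; _⊆_; ∣_∣; ⊥)
open import Data.Vec using (Vec; []; _∷_; lookup)
import Data.Vec as V
open import Data.Bool.ListAction using (any)
open import Data.Vec.Properties using (≡-dec)
open import Data.List using (List; []; _∷_; _++_; map; allFin; length; filterᵇ)
open import Data.Nat.ListAction using (sum)
open import Data.Product using (Σ; _×_; _,_)
open import Relation.Nullary using (¬_; does; yes; no)
open import Relation.Binary.PropositionalEquality using (_≡_; _≢_; sym)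
open import Function.Definitions using (Bijective)

-- Finite (abstract) simplicial complexes on the vertex set Fin n,
-- given by the Boolean indicator of their faces (subsets of Fin n).

Cx : ℕ → Set
Cx n = Subset n → Bool

allSubsets : (n : ℕ) → List (Subset n)
allSubsets zero = [] ∷ []
allSubsets (suc n) = map (true ∷_) (allSubsets n) ++ map (false ∷_) (allSubsets n)

_=ˢ_ : ∀ {n} → Subset n → Subset n → Bool
σ =ˢ τ = does (≡-dec B._≟_ σ τ)

_=ᶠ_ : ∀ {n} → Fin n → Fin n → Bool
i =ᶠ j = does (i ≟ j)

countᵇ : ∀ {A : Set} → (A → Bool) → List A → ℕ
countᵇ p xs = length (filterᵇ p xs)

image : ∀ {m n} → (Fin m → Fin n) → Subset m → Subset n
image {m} f σ = V.tabulate λ y → any (λ x → lookup σ x ∧ (f x =ᶠ y)) (allFin m)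

pair : ∀ {n} → Fin n → Fin n → Subset n
pair i j = ⁅ i ⁆ ∪ ⁅ j ⁆

triple : ∀ {n} → Fin n → Fin n → Fin n → Subset n
triple i j k = ⁅ i ⁆ ∪ (⁅ j ⁆ ∪ ⁅ k ⁆)

record IsComplex {n : ℕ} (K : Cx n) : Set where
  field
    empty-face : T (K ⊥)
    vertex-face : ∀ (i : Fin n) → T (K ⁅ i ⁆)
    down-closed : ∀ (σ τ : Subset n) → τ ⊆ σ → T (K σ) → T (K τ)

isEdge : ∀ {n} → Cx n → Fin n → Fin n → Bool
isEdge K i j = not (i =ᶠ j) ∧ K (pair i j)

-- Number of faces of cardinality k (k = 1 vertices, 2 edges, 3 triangles).
faceCount : ∀ {n} → Cx n → ℕ → ℕ
faceCount {n} K k = countᵇ (λ σ → K σ ∧ (∣ σ ∣ ≡ᵇ k)) (allSubsets n)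

data Reach {n : ℕ} (adj : Fin n → Fin n → Bool) (x : Fin n) : Fin n → Set where
  here : Reach adj x x
  step : ∀ {y z} → Reach adj x y → T (adj y z) → Reach adj x z

inLink : ∀ {n} → Cx n → Fin n → Fin n → Bool
inLink K v a = isEdge K v a

linkAdj : ∀ {n} → Cx n → Fin n → Fin n → Fin n → Bool
linkAdj K v a b = not (a =ᶠ v) ∧ not (b =ᶠ v) ∧ not (a =ᶠ b) ∧ K (triple v a b)

-- Combinatorial simplicial 2-sphere: a connected closed combinatorial
-- 2-manifold (2-dimensional, every edge in exactly two triangles, every
-- vertex link a connected (hence a single cycle)) of Euler characteristic 2.
record IsSphere2 {n : ℕ} (K : Cx n) : Set where
  field
    complex : IsComplex K
    dim≤2 : ∀ (σ : Subset n) → T (K σ) → ∣ σ ∣ ≤ 3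
    edge-in-two-triangles : ∀ (i j : Fin n) → T (isEdge K i j) →
      countᵇ (λ k → not (k =ᶠ i) ∧ not (k =ᶠ j) ∧ K (triple i j k)) (allFin n) ≡ 2
    link-connected : ∀ (v a b : Fin n) → T (inLink K v a) → T (inLink K v b) →
      Reach (linkAdj K v) a b
    connected : ∀ (a b : Fin n) → Reach (isEdge K) a b
    euler : faceCount K 1 + faceCount K 3 ≡ faceCount K 2 + 2

IsFlag : ∀ {n} → Cx n → Set
IsFlag {n} K = ∀ (σ : Subset n) →
  (∀ (i j : Fin n) → i ∈ σ → j ∈ σ → T (K (pair i j))) → T (K σ)

record IsFlagSphere2 {n : ℕ} (K : Cx n) : Set where
  field
    sphere : IsSphere2 K
    flag : IsFlag K

Iso : ∀ {m n} → Cx m → Cx n → Set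
Iso {m} {n} K L = Σ (Fin m → Fin n) λ φ →
  Bijective _≡_ _≡_ φ × (∀ (σ : Subset m) → K σ ≡ L (image φ σ))

-- K/e lives on Fin n: vertex j is removed (punched out) and
-- identified with i, which plays the role of the new vertex; the faces of
-- K/e are the images of the faces of K under this vertex map (so multiple
-- edges are identified and degenerate faces disappear).

Edge : ∀ {n} → Cx (suc n) → Set
Edge {n} K = Σ (Fin (suc n)) λ i → Σ (Fin (suc n)) λ j → (i ≢ j) × T (K (pair i j))

contractMap : ∀ {n} (i j : Fin (suc n)) → i ≢ j → Fin (suc n) → Fin n
contractMap i j i≢j x with x ≟ j
... | yes _ = punchOut {i = j} {j = i} (λ eq → i≢j (sym eq))
... | no x≢j = punchOut {i = j} {j = x} (λ eq → x≢j (sym eq))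

_/_ : ∀ {n} (K : Cx (suc n)) → Edge K → Cx n
_/_ {n} K (i , j , i≢j , _) τ =
  any (λ σ → K σ ∧ (image (contractMap i j i≢j) σ =ˢ τ)) (allSubsets (suc n))

-- Belts: four vertices a,b,c,d whose full subcomplex is the boundary of
-- the square abcd, i.e. a 4-cycle a-b-c-d-a without the diagonals ac, bd.

isBeltᵇ : ∀ {n} → Cx n → Fin n → Fin n → Fin n → Fin n → Bool
isBeltᵇ K a b c d =
  isEdge K a b ∧ isEdge K b c ∧ isEdge K c d ∧ isEdge K d a ∧
  not (K (pair a c)) ∧ not (K (pair b d))

inSomeBeltᵇ : ∀ {n} → Cx n → Fin n → Fin n → Bool
inSomeBeltᵇ {n} K u v =
  any (λ a → any (λ b → any (λ c → any (λ d →
    isBeltᵇ K a b c d ∧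
    (u =ᶠ a ∨ u =ᶠ b ∨ u =ᶠ c ∨ u =ᶠ d) ∧
    (v =ᶠ a ∨ v =ᶠ b ∨ v =ᶠ c ∨ v =ᶠ d))
    (allFin n)) (allFin n)) (allFin n)) (allFin n)

nonBeltEdgeCount : ∀ {n} → Cx n → ℕ
nonBeltEdgeCount {n} K =
  sum (map (λ u → countᵇ (λ v → (toℕ u <ᵇ toℕ v) ∧ isEdge K u v ∧ not (inSomeBeltᵇ K u v))
                         (allFin n)) (allFin n))

module Submission where

-- Proof: send each edge e to its ends in increasing order.  On edges with flag,
-- pairwise non-isomorphic contractions this is injective, since contracting
-- the same unordered edge twice gives isomorphic complexes; and its values
-- are non-belt edges by the key fact: if {a,b} is a side of a belt abcd, then
-- K/{a,b} is not flag, as the images of a, c, d are pairwise adjacent there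
-- (via bc, cd, da) while a face of K mapping onto them would contain the
-- missing diagonal ac or bd.  A pigeonhole count of lists concludes.
--
-- Both facts hold for any vertex map f merging exactly one pair of vertices,
-- with K/e replaced by the image ("pushforward") of K under f.

open import Defs
open import Data.Nat using (ℕ; suc; _≤_; _<_; _+_; _<ᵇ_; z≤n; s≤s)
open import Data.Nat.Properties using (<⇒<ᵇ; ≮⇒≥; ≤∧≢⇒<)
open import Data.Nat.ListAction using (sum)
open import Data.Bool using (Bool; true; false; T; _∧_; _∨_; not; T?; if_then_else_)
open import Data.Bool.Properties using (T-∧; T-∨; T-≡)
open import Data.Bool.ListAction using (any; or)
open import Data.Empty using (⊥; ⊥-elim)
open import Data.Sum using (_⊎_; inj₁; inj₂)
open import Data.Product using (Σ; ∃; _×_; _,_; proj₁; proj₂)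
open import Data.Fin using (Fin; toℕ; punchIn; punchOut; _≟_)
open import Data.Fin.Properties
  using (punchOut-punchIn; punchOut-injective; punchInᵢ≢i; punchOut-cong; toℕ-injective)
open import Data.Fin.Subset using (Subset; ⁅_⁆; _⊆_) renaming (_∈_ to _∈ₛ_)
open import Data.Fin.Subset.Properties using (x∈⁅x⁆; x∈⁅y⁆⇒x≡y; x∈p∪q⁻; x∈p∪q⁺; ⊆-antisym)
open import Data.Vec using ([]; _∷_; lookup; tabulate)
open import Data.Vec.Properties using ([]=⇒lookup; lookup⇒[]=; lookup∘tabulate; ≡-dec)
open import Data.List using (List; []; _∷_; length; map; allFin; filterᵇ; _++_)
open import Data.List.Properties using (length-++; length-map; map-cong)
open import Data.List.Membership.Propositional using (_∈_; lose)
open import Data.List.Membership.Propositional.Properties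
  using (∈-allFin; ∈-map⁺; ∈-++⁺ˡ; ∈-++⁺ʳ; ∈-filter⁺)
open import Data.List.Relation.Unary.Any using (here; there; satisfied)
open import Data.List.Relation.Unary.Any.Properties using (any⁺; any⁻)
import Data.List.Relation.Unary.All as All
open import Data.List.Relation.Unary.AllPairs using (AllPairs; _∷_)
import Data.List.Relation.Unary.AllPairs as AllPairs
open import Function.Bundles using (Equivalence; mk⇔)
open import Relation.Nullary using (¬_; Dec; yes; no; does)
open import Relation.Nullary.Decidable using (does-⇔)
open import Relation.Binary.PropositionalEquality
  using (_≡_; _≢_; refl; sym; trans; cong; cong₂; subst)

private
  variable
    m n : ℕ

∧-split : ∀ {a b} → T (a ∧ b) → T a × T b
∧-split = Equivalence.to T-∧

∧-intro : ∀ {a b} → T a → T b → T (a ∧ b)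
∧-intro ta tb = Equivalence.from T-∧ (ta , tb)

T-not⇒¬T : ∀ {b} → T (not b) → ¬ T b
T-not⇒¬T {false} _ ()

¬T⇒T-not : ∀ {b} → ¬ T b → T (not b)
¬T⇒T-not {true} ¬t = ¬t _
¬T⇒T-not {false} _ = _

does-sound : ∀ {A : Set} (d : Dec A) → T (does d) → A
does-sound (yes a) _ = a

does-complete : ∀ {A : Set} (d : Dec A) → A → T (does d)
does-complete (yes _) _ = _
does-complete (no ¬a) a = ¬a a

any-witness : ∀ {A : Set} {p : A → Bool} {xs : List A} → T (any p xs) → ∃ λ x → T (p x)
any-witness {p = p} {xs} t = satisfied (any⁻ p xs t)

≢⇒T-not=ᶠ : {x y : Fin n} → x ≢ y → T (not (x =ᶠ y))
≢⇒T-not=ᶠ {x = x} {y} x≢y = ¬T⇒T-not (λ t → x≢y (does-sound (x ≟ y) t))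

∈-tabulate⁻ : (g : Fin n → Bool) {y : Fin n} → y ∈ₛ tabulate g → T (g y)
∈-tabulate⁻ g {y} y∈ = Equivalence.from T-≡ (trans (sym (lookup∘tabulate g y)) ([]=⇒lookup y∈))

∈-tabulate⁺ : (g : Fin n → Bool) {y : Fin n} → T (g y) → y ∈ₛ tabulate g
∈-tabulate⁺ g {y} t = lookup⇒[]= y _ (trans (lookup∘tabulate g y) (Equivalence.to T-≡ t))

T-lookup⇒∈ : {σ : Subset n} {x : Fin n} → T (lookup σ x) → x ∈ₛ σ
T-lookup⇒∈ {σ = σ} {x} t = lookup⇒[]= x σ (Equivalence.to T-≡ t)

∈⇒T-lookup : {σ : Subset n} {x : Fin n} → x ∈ₛ σ → T (lookup σ x)
∈⇒T-lookup x∈ = Equivalence.from T-≡ ([]=⇒lookup x∈)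

∈-pair⁻ : (a b : Fin n) {x : Fin n} → x ∈ₛ pair a b → x ≡ a ⊎ x ≡ b
∈-pair⁻ a b x∈ with x∈p∪q⁻ ⁅ a ⁆ ⁅ b ⁆ x∈
... | inj₁ x∈a = inj₁ (x∈⁅y⁆⇒x≡y a x∈a)
... | inj₂ x∈b = inj₂ (x∈⁅y⁆⇒x≡y b x∈b)

∈-pairˡ : (a b : Fin n) → a ∈ₛ pair a b
∈-pairˡ a b = x∈p∪q⁺ (inj₁ (x∈⁅x⁆ a))

∈-pairʳ : (a b : Fin n) → b ∈ₛ pair a b
∈-pairʳ a b = x∈p∪q⁺ {p = ⁅ a ⁆} (inj₂ (x∈⁅x⁆ b))

pair-⊆ : {a b : Fin n} {σ : Subset n} → a ∈ₛ σ → b ∈ₛ σ → pair a b ⊆ σ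
pair-⊆ {a = a} {b} a∈ b∈ x∈ with ∈-pair⁻ a b x∈
... | inj₁ refl = a∈
... | inj₂ refl = b∈

pair-comm : (a b : Fin n) → pair a b ≡ pair b a
pair-comm a b = ⊆-antisym (pair-⊆ (∈-pairʳ b a) (∈-pairˡ b a)) (pair-⊆ (∈-pairʳ a b) (∈-pairˡ a b))

∈-triple⁻ : (a b c : Fin n) {x : Fin n} → x ∈ₛ triple a b c → x ≡ a ⊎ x ≡ b ⊎ x ≡ c
∈-triple⁻ a b c x∈ with x∈p∪q⁻ ⁅ a ⁆ _ x∈
... | inj₁ x∈a = inj₁ (x∈⁅y⁆⇒x≡y a x∈a)
... | inj₂ x∈bc = inj₂ (∈-pair⁻ b c x∈bc)

∈-triple₁ : (a b c : Fin n) → a ∈ₛ triple a b c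
∈-triple₁ a b c = x∈p∪q⁺ (inj₁ (x∈⁅x⁆ a))

∈-triple₂ : (a b c : Fin n) → b ∈ₛ triple a b c
∈-triple₂ a b c = x∈p∪q⁺ {p = ⁅ a ⁆} (inj₂ (∈-pairˡ b c))

∈-triple₃ : (a b c : Fin n) → c ∈ₛ triple a b c
∈-triple₃ a b c = x∈p∪q⁺ {p = ⁅ a ⁆} (inj₂ (∈-pairʳ b c))

allSubsets-complete : (σ : Subset n) → σ ∈ allSubsets n
allSubsets-complete [] = here refl
allSubsets-complete {suc n} (true ∷ σ) = ∈-++⁺ˡ (∈-map⁺ (true ∷_) (allSubsets-complete σ))
allSubsets-complete {suc n} (false ∷ σ) =
  ∈-++⁺ʳ (map (true ∷_) (allSubsets n)) (∈-map⁺ (false ∷_) (allSubsets-complete σ))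

=ˢ⇒≡ : {σ τ : Subset n} → T (σ =ˢ τ) → σ ≡ τ
=ˢ⇒≡ {σ = σ} {τ} = does-sound (≡-dec Data.Bool._≟_ σ τ)

≡⇒=ˢ : {σ τ : Subset n} → σ ≡ τ → T (σ =ˢ τ)
≡⇒=ˢ {σ = σ} {τ} = does-complete (≡-dec Data.Bool._≟_ σ τ)

∈-image⁻ : (f : Fin m → Fin n) (σ : Subset m) {y : Fin n} →
  y ∈ₛ image f σ → ∃ λ x → x ∈ₛ σ × f x ≡ y
∈-image⁻ {m} f σ {y} y∈ =
  let
    (x , x∈σ∧fx=y) = any-witness {xs = allFin m} (∈-tabulate⁻ _ y∈)
    (x∈σ , fx=y) = ∧-split {lookup σ x} x∈σ∧fx=y
  in x , T-lookup⇒∈ x∈σ , does-sound (f x ≟ y) fx=y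

∈-image⁺ : (f : Fin m → Fin n) {σ : Subset m} {x : Fin m} → x ∈ₛ σ → f x ∈ₛ image f σ
∈-image⁺ f {x = x} x∈ =
  ∈-tabulate⁺ _ (any⁺ _ (lose (∈-allFin x) (∧-intro (∈⇒T-lookup x∈) (does-complete (f x ≟ f x) refl))))

image-pair : (f : Fin m → Fin n) (u v : Fin m) → image f (pair u v) ≡ pair (f u) (f v)
image-pair f u v = ⊆-antisym image⊆ ⊆image
  where
  image⊆ : image f (pair u v) ⊆ pair (f u) (f v)
  image⊆ y∈ with ∈-image⁻ f (pair u v) y∈
  ... | x , x∈ , refl with ∈-pair⁻ u v x∈
  ... | inj₁ refl = ∈-pairˡ (f u) (f v)
  ... | inj₂ refl = ∈-pairʳ (f u) (f v)
  ⊆image : pair (f u) (f v) ⊆ image f (pair u v)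
  ⊆image y∈ with ∈-pair⁻ (f u) (f v) y∈
  ... | inj₁ refl = ∈-image⁺ f (∈-pairˡ u v)
  ... | inj₂ refl = ∈-image⁺ f (∈-pairʳ u v)

image-∘ : ∀ {l} (f : Fin l → Fin m) (g : Fin m → Fin n) (h : Fin l → Fin n) →
  (∀ x → g (f x) ≡ h x) → ∀ σ → image h σ ≡ image g (image f σ)
image-∘ f g h g∘f≗h σ = ⊆-antisym ⊆gf gf⊆
  where
  ⊆gf : image h σ ⊆ image g (image f σ)
  ⊆gf y∈ with ∈-image⁻ h σ y∈
  ... | x , x∈ , refl = subst (_∈ₛ image g (image f σ)) (g∘f≗h x) (∈-image⁺ g (∈-image⁺ f x∈))
  gf⊆ : image g (image f σ) ⊆ image h σ
  gf⊆ y∈ with ∈-image⁻ g (image f σ) y∈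
  ... | z , z∈ , refl with ∈-image⁻ f σ z∈
  ... | x , x∈ , refl = subst (_∈ₛ image h σ) (sym (g∘f≗h x)) (∈-image⁺ h x∈)

image-injective : (g : Fin m → Fin n) → (∀ {x y} → g x ≡ g y → x ≡ y) →
  ∀ σ τ → image g σ ≡ image g τ → σ ≡ τ
image-injective g g-inj σ τ eq = ⊆-antisym (included σ τ eq) (included τ σ (sym eq))
  where
  included : ∀ σ τ → image g σ ≡ image g τ → σ ⊆ τ
  included σ τ eq x∈ with ∈-image⁻ g τ (subst (g _ ∈ₛ_) eq (∈-image⁺ g x∈))
  ... | x′ , x′∈ , gx′≡gx = subst (_∈ₛ τ) (g-inj gx′≡gx) x′∈

-- Pushforward complexes: the faces of pushforward K f are the images of the
-- faces of K.  An edge contraction K / e is the pushforward along contractMap.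

pushforward : Cx m → (Fin m → Fin n) → Cx n
pushforward {m} K f τ = any (λ σ → K σ ∧ (image f σ =ˢ τ)) (allSubsets m)

pushforward-face : (K : Cx m) (f : Fin m → Fin n) {σ : Subset m} →
  T (K σ) → T (pushforward K f (image f σ))
pushforward-face K f {σ} Kσ =
  any⁺ _ (lose (allSubsets-complete σ) (∧-intro Kσ (≡⇒=ˢ {σ = image f σ} refl)))

pushforward-face⁻ : (K : Cx m) (f : Fin m → Fin n) {τ : Subset n} →
  T (pushforward K f τ) → ∃ λ σ → T (K σ) × image f σ ≡ τ
pushforward-face⁻ {m} K f {τ} t =
  let
    (σ , Kσ∧fσ=τ) = any-witness {xs = allSubsets m} t
    (Kσ , fσ=τ) = ∧-split {K σ} Kσ∧fσ=τ
  in σ , Kσ , =ˢ⇒≡ {σ = image f σ} fσ=τ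

-- Two surjective vertex maps with the same fibres have isomorphic
-- pushforwards: the isomorphism is y ↦ g (s y) for a section s of f.
pushforward-iso : (K : Cx m) (f g : Fin m → Fin n) (s t : Fin n → Fin m) →
  (∀ y → f (s y) ≡ y) → (∀ y → g (t y) ≡ y) →
  (∀ x y → f x ≡ f y → g x ≡ g y) → (∀ x y → g x ≡ g y → f x ≡ f y) →
  Iso (pushforward K f) (pushforward K g)
pushforward-iso {m = m} {n = n} K f g s t fs≗id gt≗id f⇒g g⇒f = φ , (φ-injective , φ-surjective) , faces
  where
  φ : Fin n → Fin n
  φ y = g (s y)
  φ∘f≗g : ∀ x → φ (f x) ≡ g x
  φ∘f≗g x = f⇒g _ _ (fs≗id (f x))
  φ-injective : ∀ {a b} → φ a ≡ φ b → a ≡ b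
  φ-injective {a} {b} eq = trans (sym (fs≗id a)) (trans (g⇒f _ _ eq) (fs≗id b))
  φ-surjective : ∀ y → ∃ λ x → ∀ {z} → z ≡ x → φ z ≡ y
  φ-surjective y = f (t y) , λ { refl → trans (φ∘f≗g (t y)) (gt≗id y) }
  image-g≡φ∘image-f : ∀ σ → image g σ ≡ image φ (image f σ)
  image-g≡φ∘image-f = image-∘ f φ g φ∘f≗g
  sameImage : ∀ τ σ → (image f σ =ˢ τ) ≡ (image g σ =ˢ image φ τ)
  sameImage τ σ = does-⇔ (mk⇔ to from) (≡-dec Data.Bool._≟_ _ _) (≡-dec Data.Bool._≟_ _ _)
    where
    to : image f σ ≡ τ → image g σ ≡ image φ τ
    to eq = trans (image-g≡φ∘image-f σ) (cong (image φ) eq)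
    from : image g σ ≡ image φ τ → image f σ ≡ τ
    from eq = image-injective φ φ-injective _ _ (trans (sym (image-g≡φ∘image-f σ)) eq)
  faces : ∀ τ → pushforward K f τ ≡ pushforward K g (image φ τ)
  faces τ = cong or (map-cong (λ σ → cong (K σ ∧_) (sameImage τ σ)) (allSubsets m))

-- Merging maps.  A vertex map f merges a and b if it identifies a with b and
-- nothing else; its fibres are then determined by the unordered pair {a,b}.

Endpoint : Fin m → Fin m → Fin m → Set
Endpoint a b x = x ≡ a ⊎ x ≡ b

record Merges (f : Fin m → Fin n) (a b : Fin m) : Set where
  field
    merged : f a ≡ f b
    only   : ∀ {x y} → f x ≡ f y → x ≡ y ⊎ (Endpoint a b x × Endpoint a b y)

merges-swap : {f : Fin m → Fin n} {a b : Fin m} → Merges f a b → Merges f b a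
merges-swap M = record { merged = sym merged ; only = λ eq → swap (only eq) }
  where
  open Merges M
  flip : ∀ {x} → Endpoint _ _ x → Endpoint _ _ x
  flip (inj₁ x≡a) = inj₂ x≡a
  flip (inj₂ x≡b) = inj₁ x≡b
  swap : ∀ {x y} → x ≡ y ⊎ (Endpoint _ _ x × Endpoint _ _ y) → x ≡ y ⊎ (Endpoint _ _ x × Endpoint _ _ y)
  swap (inj₁ x≡y) = inj₁ x≡y
  swap (inj₂ (ex , ey)) = inj₂ (flip ex , flip ey)

merges-fibres : {f : Fin m → Fin n} {g : Fin m → Fin n} {a b : Fin m} →
  Merges f a b → Merges g a b → ∀ x y → f x ≡ f y → g x ≡ g y
merges-fibres {g = g} {a} {b} Mf Mg x y fx≡fy with Merges.only Mf fx≡fy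
... | inj₁ refl = refl
... | inj₂ (ex , ey) = trans (to-a ex) (sym (to-a ey))
  where
  to-a : ∀ {z} → Endpoint a b z → g z ≡ g a
  to-a (inj₁ refl) = refl
  to-a (inj₂ refl) = sym (Merges.merged Mg)

module Contraction {n : ℕ} (i j : Fin (suc n)) (i≢j : i ≢ j) where

  contract : Fin (suc n) → Fin n
  contract = contractMap i j i≢j

  contract-other : ∀ x (x≢j : x ≢ j) → contract x ≡ punchOut (λ j≡x → x≢j (sym j≡x))
  contract-other x x≢j with x ≟ j
  ... | yes x≡j = ⊥-elim (x≢j x≡j)
  ... | no _ = punchOut-cong j refl

  contract-j : ∀ x → x ≡ j → contract x ≡ contract i
  contract-j x refl with j ≟ j
  ... | yes _ = sym (contract-other i i≢j)
  ... | no j≢j = ⊥-elim (j≢j refl)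

  contract-section : ∀ y → contract (punchIn j y) ≡ y
  contract-section y =
    trans (contract-other (punchIn j y) (punchInᵢ≢i j y)) (trans (punchOut-cong j refl) (punchOut-punchIn j))

  contract-merges : Merges contract i j
  contract-merges = record { merged = sym (contract-j j refl) ; only = fibre }
    where
    -- Deciding x ≟ j and y ≟ j unfolds contract on both sides to punchOut,
    -- which is injective.
    fibre : ∀ {x y} → contract x ≡ contract y → x ≡ y ⊎ (Endpoint i j x × Endpoint i j y)
    fibre {x} {y} eq with x ≟ j | y ≟ j
    ... | yes x≡j | yes y≡j = inj₁ (trans x≡j (sym y≡j))
    ... | yes x≡j | no _    = inj₂ (inj₂ x≡j , inj₁ (sym (punchOut-injective {i = j} _ _ eq)))
    ... | no _    | yes y≡j = inj₂ (inj₁ (punchOut-injective {i = j} _ _ eq) , inj₂ y≡j)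
    ... | no _    | no _    = inj₁ (punchOut-injective {i = j} _ _ eq)

edgeMap : (K : Cx (suc n)) → Edge K → Fin (suc n) → Fin n
edgeMap K (i , j , i≢j , _) = contractMap i j i≢j

edgeMap-merges : (K : Cx (suc n)) (e : Edge K) → Merges (edgeMap K e) (proj₁ e) (proj₁ (proj₂ e))
edgeMap-merges K (i , j , i≢j , _) = Contraction.contract-merges i j i≢j

contractions-iso : (K : Cx (suc n)) (e e′ : Edge K) {a b : Fin (suc n)} →
  Merges (edgeMap K e) a b → Merges (edgeMap K e′) a b → Iso (K / e) (K / e′)
contractions-iso K (i , j , i≢j , _) (i′ , j′ , i′≢j′ , _) M M′ =
  pushforward-iso K (contractMap i j i≢j) (contractMap i′ j′ i′≢j′) (punchIn j) (punchIn j′)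
    (Contraction.contract-section i j i≢j) (Contraction.contract-section i′ j′ i′≢j′)
    (merges-fibres M M′) (merges-fibres M′ M)

edge-sym : {K : Cx n} {u v : Fin n} → T (K (pair u v)) → T (K (pair v u))
edge-sym {K = K} {u} {v} = subst (λ σ → T (K σ)) (pair-comm u v)

face-pair : {K : Cx n} → IsComplex K → {σ : Subset n} {u v : Fin n} →
  T (K σ) → u ∈ₛ σ → v ∈ₛ σ → T (K (pair u v))
face-pair cx {σ} {u} {v} Kσ u∈ v∈ = IsComplex.down-closed cx σ (pair u v) (pair-⊆ u∈ v∈) Kσ

-- The singleton {u} of an edge end u, written as the degenerate pair {u,u}.
degenerate-pair : {K : Cx n} → IsComplex K → {u v : Fin n} → T (K (pair u v)) → T (K (pair u u))
degenerate-pair cx {u} {v} uv = face-pair cx uv (∈-pairˡ u v) (∈-pairˡ u v)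

record Belt (K : Cx n) (a b c d : Fin n) : Set where
  field
    a≢b : a ≢ b
    ab  : T (K (pair a b))
    b≢c : b ≢ c
    bc  : T (K (pair b c))
    c≢d : c ≢ d
    cd  : T (K (pair c d))
    d≢a : d ≢ a
    da  : T (K (pair d a))
    no-ac : ¬ T (K (pair a c))
    no-bd : ¬ T (K (pair b d))

rotate : {K : Cx n} {a b c d : Fin n} → Belt K a b c d → Belt K b c d a
rotate {K = K} B = record
  { a≢b = b≢c ; ab = bc ; b≢c = c≢d ; bc = cd ; c≢d = d≢a ; cd = da ; d≢a = a≢b ; da = ab
  ; no-ac = no-bd ; no-bd = λ ca → no-ac (edge-sym {K = K} ca) }
  where open Belt B

isEdge-sound : (K : Cx n) (a b : Fin n) → T (isEdge K a b) → a ≢ b × T (K (pair a b))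
isEdge-sound K a b t =
  let (a≢b , ab) = ∧-split {not (a =ᶠ b)} t
  in (λ a≡b → T-not⇒¬T a≢b (does-complete (a ≟ b) a≡b)) , ab

isBeltᵇ-sound : {K : Cx n} {a b c d : Fin n} → T (isBeltᵇ K a b c d) → Belt K a b c d
isBeltᵇ-sound {K = K} {a} {b} {c} {d} t =
  let
    (ab? , t₁) = ∧-split {isEdge K a b} t
    (bc? , t₂) = ∧-split {isEdge K b c} t₁
    (cd? , t₃) = ∧-split {isEdge K c d} t₂
    (da? , diagonals) = ∧-split {isEdge K d a} t₃
    (no-ac? , no-bd?) = ∧-split {not (K (pair a c))} diagonals
    (a≢b , ab) = isEdge-sound K a b ab?
    (b≢c , bc) = isEdge-sound K b c bc?
    (c≢d , cd) = isEdge-sound K c d cd?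
    (d≢a , da) = isEdge-sound K d a da?
  in record
    { a≢b = a≢b ; ab = ab ; b≢c = b≢c ; bc = bc ; c≢d = c≢d ; cd = cd ; d≢a = d≢a ; da = da
    ; no-ac = T-not⇒¬T no-ac? ; no-bd = T-not⇒¬T no-bd? }

Corner : Fin n → Fin n → Fin n → Fin n → Fin n → Set
Corner u a b c d = u ≡ a ⊎ u ≡ b ⊎ u ≡ c ⊎ u ≡ d

corner-rotate : {u a b c d : Fin n} → Corner u a b c d → Corner u b c d a
corner-rotate (inj₁ u≡a) = inj₂ (inj₂ (inj₂ u≡a))
corner-rotate (inj₂ (inj₁ u≡b)) = inj₁ u≡b
corner-rotate (inj₂ (inj₂ (inj₁ u≡c))) = inj₂ (inj₁ u≡c)
corner-rotate (inj₂ (inj₂ (inj₂ u≡d))) = inj₂ (inj₂ (inj₁ u≡d))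

corner-sound : {u a b c d : Fin n} → T ((u =ᶠ a) ∨ (u =ᶠ b) ∨ (u =ᶠ c) ∨ (u =ᶠ d)) → Corner u a b c d
corner-sound {u = u} {a} {b} {c} {d} t with Equivalence.to T-∨ t
... | inj₁ ua = inj₁ (does-sound (u ≟ a) ua)
... | inj₂ t′ with Equivalence.to T-∨ t′
... | inj₁ ub = inj₂ (inj₁ (does-sound (u ≟ b) ub))
... | inj₂ t″ with Equivalence.to T-∨ t″
... | inj₁ uc = inj₂ (inj₂ (inj₁ (does-sound (u ≟ c) uc)))
... | inj₂ ud = inj₂ (inj₂ (inj₂ (does-sound (u ≟ d) ud)))

record BeltThrough (K : Cx n) (u v : Fin n) : Set where
  field
    {a b c d} : Fin n
    belt : Belt K a b c d
    u-corner : Corner u a b c d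
    v-corner : Corner v a b c d

inSomeBeltᵇ-sound : {K : Cx n} {u v : Fin n} → T (inSomeBeltᵇ K u v) → BeltThrough K u v
inSomeBeltᵇ-sound {n} {K} {u} {v} t =
  let
    (a , t₁) = any-witness {xs = allFin n} t
    (b , t₂) = any-witness {xs = allFin n} t₁
    (c , t₃) = any-witness {xs = allFin n} t₂
    (d , found) = any-witness {xs = allFin n} t₃
  in candidate {a} {b} {c} {d} found
  where
  candidate : ∀ {a b c d} →
    T (isBeltᵇ K a b c d ∧ ((u =ᶠ a) ∨ (u =ᶠ b) ∨ (u =ᶠ c) ∨ (u =ᶠ d))
                         ∧ ((v =ᶠ a) ∨ (v =ᶠ b) ∨ (v =ᶠ c) ∨ (v =ᶠ d))) →
    BeltThrough K u v
  candidate {a} {b} {c} {d} found =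
    let
      (belt? , corners) = ∧-split {isBeltᵇ K a b c d} found
      (u-corner? , v-corner?) = ∧-split {(u =ᶠ a) ∨ (u =ᶠ b) ∨ (u =ᶠ c) ∨ (u =ᶠ d)} corners
    in record
      { belt = isBeltᵇ-sound {K = K} belt?
      ; u-corner = corner-sound u-corner?
      ; v-corner = corner-sound v-corner? }

BeltSide : Cx n → Fin n → Fin n → Set
BeltSide {n} K u v = Σ (Fin n) λ c → Σ (Fin n) λ d → Belt K u v c d

-- An edge joining two corners of a belt is one of its sides.  Rotating the
-- belt we may assume u is its first corner a; then v = b or v = d, since
-- v ≠ a and av is an edge but ac is not.
side-from-first : {K : Cx n} {a b c d v : Fin n} → Belt K a b c d → Corner v a b c d →
  a ≢ v → T (K (pair a v)) → BeltSide K a v ⊎ BeltSide K v a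
side-from-first B (inj₁ refl) a≢v _ = ⊥-elim (a≢v refl)
side-from-first B (inj₂ (inj₁ refl)) _ _ = inj₁ (_ , _ , B)
side-from-first B (inj₂ (inj₂ (inj₁ refl))) _ av = ⊥-elim (Belt.no-ac B av)
side-from-first B (inj₂ (inj₂ (inj₂ refl))) _ _ = inj₂ (_ , _ , rotate (rotate (rotate B)))

side-of-belt : {K : Cx n} {u v : Fin n} → BeltThrough K u v →
  u ≢ v → T (K (pair u v)) → BeltSide K u v ⊎ BeltSide K v u
side-of-belt record { belt = B ; u-corner = inj₁ refl ; v-corner = v∈ } =
  side-from-first B v∈
side-of-belt record { belt = B ; u-corner = inj₂ (inj₁ refl) ; v-corner = v∈ } =
  side-from-first (rotate B) (corner-rotate v∈)
side-of-belt record { belt = B ; u-corner = inj₂ (inj₂ (inj₁ refl)) ; v-corner = v∈ } =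
  side-from-first (rotate (rotate B)) (corner-rotate (corner-rotate v∈))
side-of-belt record { belt = B ; u-corner = inj₂ (inj₂ (inj₂ refl)) ; v-corner = v∈ } =
  side-from-first (rotate (rotate (rotate B))) (corner-rotate (corner-rotate (corner-rotate v∈)))

-- If f merges the ends a, b of a side of a belt abcd, the
-- pushforward L of K along f is not flag: f a, f c, f d are pairwise
-- adjacent in L (through the sides bc, cd, da, using f b = f a), so they
-- span a face, the image of some face σ of K.  As f is injective away from
-- {a,b}, σ contains c, d and one of a, b, hence the diagonal ac or bd.
belt-side-blocks-flag : {K : Cx m} → IsComplex K → {f : Fin m → Fin n} {a b c d : Fin m} →
  Belt K a b c d → Merges f a b → ¬ IsFlag (pushforward K f)
belt-side-blocks-flag {m = m} {n = n} {K = K} cx {f} {a} {b} {c} {d} B M flag = diagonal-in-σ a-or-b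
  where
  open Belt B
  open Merges M
  L : Cx n
  L = pushforward K f
  τ : Subset m
  τ = triple a c d

  edge-image : ∀ {x y} → T (K (pair x y)) → T (L (pair (f x) (f y)))
  edge-image {x} {y} xy = subst (λ ρ → T (L ρ)) (image-pair f x y) (pushforward-face K f xy)

  fa-fc : T (L (pair (f a) (f c)))
  fa-fc = subst (λ z → T (L (pair z (f c)))) (sym merged) (edge-image bc)

  adjacent : ∀ {x y} → x ∈ₛ τ → y ∈ₛ τ → T (L (pair (f x) (f y)))
  adjacent x∈ y∈ with ∈-triple⁻ a c d x∈ | ∈-triple⁻ a c d y∈
  ... | inj₁ refl        | inj₁ refl        = edge-image (degenerate-pair cx ab)
  ... | inj₁ refl        | inj₂ (inj₁ refl) = fa-fc
  ... | inj₁ refl        | inj₂ (inj₂ refl) = edge-image (edge-sym {K = K} da)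
  ... | inj₂ (inj₁ refl) | inj₁ refl        = edge-sym {K = L} fa-fc
  ... | inj₂ (inj₁ refl) | inj₂ (inj₁ refl) = edge-image (degenerate-pair cx cd)
  ... | inj₂ (inj₁ refl) | inj₂ (inj₂ refl) = edge-image cd
  ... | inj₂ (inj₂ refl) | inj₁ refl        = edge-image da
  ... | inj₂ (inj₂ refl) | inj₂ (inj₁ refl) = edge-image (edge-sym {K = K} cd)
  ... | inj₂ (inj₂ refl) | inj₂ (inj₂ refl) = edge-image (degenerate-pair cx da)

  image-is-face : T (L (image f τ))
  image-is-face = flag (image f τ) pairwise
    where
    pairwise : ∀ x y → x ∈ₛ image f τ → y ∈ₛ image f τ → T (L (pair x y))
    pairwise x y x∈ y∈ with ∈-image⁻ f τ x∈ | ∈-image⁻ f τ y∈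
    ... | _ , x′∈ , refl | _ , y′∈ , refl = adjacent x′∈ y′∈

  preimage : ∃ λ σ → T (K σ) × image f σ ≡ image f τ
  preimage = pushforward-face⁻ K f image-is-face
  σ : Subset m
  σ = proj₁ preimage
  Kσ : T (K σ)
  Kσ = proj₁ (proj₂ preimage)

  in-fibre : ∀ {w} → w ∈ₛ τ → ∃ λ x → x ∈ₛ σ × f x ≡ f w
  in-fibre {w} w∈ = ∈-image⁻ f σ (subst (f w ∈ₛ_) (sym (proj₂ (proj₂ preimage))) (∈-image⁺ f w∈))

  unmerged-in-σ : ∀ {w} → w ∈ₛ τ → w ≢ a → w ≢ b → w ∈ₛ σ
  unmerged-in-σ w∈ w≢a w≢b with in-fibre w∈
  ... | x , x∈ , fx≡fw with only fx≡fw
  ...   | inj₁ refl = x∈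
  ...   | inj₂ (_ , inj₁ w≡a) = ⊥-elim (w≢a w≡a)
  ...   | inj₂ (_ , inj₂ w≡b) = ⊥-elim (w≢b w≡b)

  c∈σ : c ∈ₛ σ
  c∈σ = unmerged-in-σ (∈-triple₂ a c d) (λ { refl → no-ac (degenerate-pair cx ab) }) (λ c≡b → b≢c (sym c≡b))

  d∈σ : d ∈ₛ σ
  d∈σ = unmerged-in-σ (∈-triple₃ a c d) d≢a (λ { refl → no-bd (degenerate-pair cx (edge-sym {K = K} ab)) })

  a-or-b : ∃ λ x → x ∈ₛ σ × Endpoint a b x
  a-or-b with in-fibre (∈-triple₁ a c d)
  ... | x , x∈ , fx≡fa with only fx≡fa
  ...   | inj₁ refl = x , x∈ , inj₁ refl
  ...   | inj₂ (x∈ab , _) = x , x∈ , x∈ab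

  diagonal-in-σ : (∃ λ x → x ∈ₛ σ × Endpoint a b x) → ⊥
  diagonal-in-σ (x , x∈ , inj₁ refl) = no-ac (face-pair cx Kσ x∈ c∈σ)
  diagonal-in-σ (x , x∈ , inj₂ refl) = no-bd (face-pair cx Kσ x∈ d∈σ)

merged-edge-in-no-belt : {K : Cx m} → IsComplex K → {f : Fin m → Fin n} {u v : Fin m} →
  Merges f u v → u ≢ v → T (K (pair u v)) → IsFlag (pushforward K f) → ¬ T (inSomeBeltᵇ K u v)
merged-edge-in-no-belt cx M u≢v uv flag inBelt with side-of-belt (inSomeBeltᵇ-sound inBelt) u≢v uv
... | inj₁ (_ , _ , B) = belt-side-blocks-flag cx B M flag
... | inj₂ (_ , _ , B) = belt-side-blocks-flag cx B (merges-swap M) flag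

sortedEnds : (K : Cx (suc n)) → Edge K → Fin (suc n) × Fin (suc n)
sortedEnds K (i , j , _) = if toℕ i <ᵇ toℕ j then (i , j) else (j , i)

record SortedEnds (K : Cx (suc n)) (e : Edge K) (u v : Fin (suc n)) : Set where
  field
    increasing : T (toℕ u <ᵇ toℕ v)
    distinct   : u ≢ v
    face       : T (K (pair u v))
    merges     : Merges (edgeMap K e) u v

sortedEnds-spec : (K : Cx (suc n)) (e : Edge K) →
  SortedEnds K e (proj₁ (sortedEnds K e)) (proj₂ (sortedEnds K e))
sortedEnds-spec K e@(i , j , i≢j , ij) with toℕ i <ᵇ toℕ j in i<j
... | true = record
  { increasing = subst T (sym i<j) _ ; distinct = i≢j ; face = ij ; merges = edgeMap-merges K e }
... | false = record
  { increasing = <⇒<ᵇ j<i ; distinct = λ j≡i → i≢j (sym j≡i)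
  ; face = edge-sym {K = K} ij ; merges = merges-swap (edgeMap-merges K e) }
  where
  j<i : toℕ j < toℕ i
  j<i = ≤∧≢⇒< (≮⇒≥ (λ i<j′ → subst T i<j (<⇒<ᵇ i<j′))) (λ j≡i → i≢j (toℕ-injective (sym j≡i)))

sortedEnds-iso : (K : Cx (suc n)) (e e′ : Edge K) → sortedEnds K e ≡ sortedEnds K e′ → Iso (K / e) (K / e′)
sortedEnds-iso K e e′ same = contractions-iso K e e′ (SortedEnds.merges (sortedEnds-spec K e))
  (subst (λ ends → Merges (edgeMap K e′) (proj₁ ends) (proj₂ ends)) (sym same)
    (SortedEnds.merges (sortedEnds-spec K e′)))

pairsWith : {A B : Set} → (A → B → Bool) → List A → List B → List (A × B)
pairsWith P [] vs = []
pairsWith P (u ∷ us) vs = map (u ,_) (filterᵇ (P u) vs) ++ pairsWith P us vs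

length-pairsWith : {A B : Set} (P : A → B → Bool) (us : List A) (vs : List B) →
  length (pairsWith P us vs) ≡ sum (map (λ u → countᵇ (P u) vs) us)
length-pairsWith P [] vs = refl
length-pairsWith P (u ∷ us) vs =
  trans (length-++ (map (u ,_) (filterᵇ (P u) vs)))
    (cong₂ _+_ (length-map (u ,_) (filterᵇ (P u) vs)) (length-pairsWith P us vs))

∈-pairsWith : {A B : Set} (P : A → B → Bool) {us : List A} {vs : List B} {u : A} {v : B} →
  u ∈ us → v ∈ vs → T (P u v) → (u , v) ∈ pairsWith P us vs
∈-pairsWith P {u ∷ us} {vs} (here refl) v∈ Puv = ∈-++⁺ˡ (∈-map⁺ (u ,_) (∈-filter⁺ (λ w → T? (P u w)) v∈ Puv))
∈-pairsWith P {w ∷ us} {vs} (there u∈) v∈ Puv = ∈-++⁺ʳ (map (w ,_) (filterᵇ (P w) vs)) (∈-pairsWith P u∈ v∈ Puv)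

nonBeltTest : Cx n → Fin n → Fin n → Bool
nonBeltTest K u v = (toℕ u <ᵇ toℕ v) ∧ isEdge K u v ∧ not (inSomeBeltᵇ K u v)

nonBeltPairs : Cx n → List (Fin n × Fin n)
nonBeltPairs {n} K = pairsWith (nonBeltTest K) (allFin n) (allFin n)

length-nonBeltPairs : (K : Cx n) → length (nonBeltPairs K) ≡ nonBeltEdgeCount K
length-nonBeltPairs {n} K = length-pairsWith (nonBeltTest K) (allFin n) (allFin n)

sortedEnds-nonBelt : (K : Cx (suc n)) → IsComplex K → (e : Edge K) → IsFlag (K / e) →
  sortedEnds K e ∈ nonBeltPairs K
sortedEnds-nonBelt K cx e@(_ , _ , _ , _) flag =
  ∈-pairsWith (nonBeltTest K) (∈-allFin _) (∈-allFin _)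
    (∧-intro increasing (∧-intro (∧-intro (≢⇒T-not=ᶠ distinct) face)
      (¬T⇒T-not (merged-edge-in-no-belt cx merges distinct face flag))))
  where open SortedEnds (sortedEnds-spec K e)

_without_ : {A : Set} {x : A} (ys : List A) → x ∈ ys → List A
(_ ∷ ys) without here _ = ys
(y ∷ ys) without there x∈ = y ∷ (ys without x∈)

length-without : {A : Set} {x : A} (ys : List A) (x∈ : x ∈ ys) → length ys ≡ suc (length (ys without x∈))
length-without (_ ∷ ys) (here _) = refl
length-without (y ∷ ys) (there x∈) = cong suc (length-without ys x∈)

∈-without : {A : Set} {x z : A} (ys : List A) (x∈ : x ∈ ys) → z ∈ ys → z ≢ x → z ∈ ys without x∈
∈-without (_ ∷ ys) (here refl) (here refl) z≢x = ⊥-elim (z≢x refl)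
∈-without (_ ∷ ys) (here refl) (there z∈) _ = z∈
∈-without (y ∷ ys) (there x∈) (here refl) _ = here refl
∈-without (y ∷ ys) (there x∈) (there z∈) z≢x = there (∈-without ys x∈ z∈ z≢x)

pigeonhole : {A B : Set} (k : A → B) (xs : List A) (ys : List B) →
  AllPairs (λ x x′ → k x ≢ k x′) xs → (∀ x → x ∈ xs → k x ∈ ys) → length xs ≤ length ys
pigeonhole k [] ys _ _ = z≤n
pigeonhole k (x ∷ xs) ys (x-distinct ∷ xs-distinct) into =
  subst (suc (length xs) ≤_) (sym (length-without ys kx∈))
    (s≤s (pigeonhole k xs (ys without kx∈) xs-distinct into-rest))
  where
  kx∈ : k x ∈ ys
  kx∈ = into x (here refl)
  into-rest : ∀ x′ → x′ ∈ xs → k x′ ∈ ys without kx∈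
  into-rest x′ x′∈ = ∈-without ys kx∈ (into x′ (there x′∈)) (λ kx′≡kx → All.lookup x-distinct x′∈ (sym kx′≡kx))

corollary2 : ∀ {n : ℕ} (K : Cx (suc n)) → IsFlagSphere2 K →
    (es : List (Edge K)) →
    (∀ e → e ∈ es → IsFlagSphere2 (K / e)) →
    AllPairs (λ e e′ → ¬ Iso (K / e) (K / e′)) es →
    length es ≤ nonBeltEdgeCount K
corollary2 K sphere es flag-contractions non-isomorphic =
  subst (length es ≤_) (length-nonBeltPairs K)
    (pigeonhole (sortedEnds K) es (nonBeltPairs K) distinct-ends non-belt)
  where
  cx : IsComplex K
  cx = IsSphere2.complex (IsFlagSphere2.sphere sphere)
  distinct-ends : AllPairs (λ e e′ → sortedEnds K e ≢ sortedEnds K e′) es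
  distinct-ends = AllPairs.map (λ {e} {e′} ¬iso same → ¬iso (sortedEnds-iso K e e′ same)) non-isomorphic
  non-belt : ∀ e → e ∈ es → sortedEnds K e ∈ nonBeltPairs K
  non-belt e e∈ = sortedEnds-nonBelt K cx e (IsFlagSphere2.flag (flag-contractions e e∈))
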